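{- Let $G$ be a graph and let $l$ be an intersecting supermodular integer-valued function on subsets of $V(G)$. Let $H$ be an $l$-partition-connected spanning subgraph of $G$ and let $M$ be a nonempty subset of $E(H)$. If an edge $e'\in E(G)\setminus E(H)$ joins different $l$-partition-connected components of $H\setminus M$, then there is an edge $e\in M$ such that $H-e+e'$ is $l$-partition-connected.
   Context: Graphs are finite, loopless, and may have multiple edges. $l(\emptyset)=0$. $l$ is intersecting supermodular if $l(A\cap B)+l(A\cup B)\ge l(A)+l(B)$ whenever $A\cap B\neq\emptyset$. $H\setminus M$ is the spanning subgraph obtained by deleting the edges of $M$. For a partition $P$ of $V(K)$, $e_K(P)$ is the number of edges joining different parts; $K$ is $l$-partition-connected if $e_K(P)\ge\sum_{A\in P}l(A)-l(V(K))$ for every partition $P$. The $l$-partition-connected components of $K$ are the induced subgraphs on the maximal vertex sets $Y$ with $K[Y]$ $l$-partition-connected; these sets partition $V(K)$. -}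

module Defs where

open import Data.Nat using (ℕ)
open import Data.Bool using (Bool; true; false; _∧_; not)
open import Data.Fin using (Fin)
open import Data.Fin.Subset using (Subset; _∈_; _∉_; _⊆_; _∩_; _∪_; ⊥; ⊤; Nonempty; ∣_∣; inside; outside)
open import Data.Fin.Subset.Properties using (_∈?_)
open import Data.Fin.Properties using (_≟_)
open import Data.Vec using (tabulate)
open import Data.Integer using (ℤ; +_; _+_; _-_; _≤_; 0ℤ)
open import Data.Product using (_×_; _,_; proj₁; proj₂; Σ; ∃)
open import Relation.Nullary.Decidable using (⌊_⌋)
open import Relation.Binary.PropositionalEquality using (_≡_; _≢_)

record Graph (n m : ℕ) : Set where
  field
    ends    : Fin m → Fin n × Fin n
    loopless : ∀ e → proj₁ (ends e) ≢ proj₂ (ends e)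
open Graph public

SetFn : ℕ → Set
SetFn n = Subset n → ℤ

IntersectingSupermodular : ∀ {n} → SetFn n → Set
IntersectingSupermodular l =
  ∀ A B → Nonempty (A ∩ B) → l A + l B ≤ l (A ∩ B) + l (A ∪ B)

sumFin : ∀ {k : ℕ} → (Fin k → ℤ) → ℤ
sumFin {ℕ.zero}  f = 0ℤ
sumFin {ℕ.suc k} f = f Fin.zero + sumFin (λ i → f (Fin.suc i))

module _ {n m : ℕ} (G : Graph n m) where

  -- A partition of a vertex set Y into k (nonempty) parts, given by a
  -- labelling p of the vertices: part i = { v ∈ Y | p v ≡ i }.
  IsPartitionOf : Subset n → ∀ {k} → (Fin n → Fin k) → Set
  IsPartitionOf Y {k} p = ∀ (i : Fin k) → ∃ λ v → v ∈ Y × p v ≡ i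

  part : Subset n → ∀ {k} → (Fin n → Fin k) → Fin k → Subset n
  part Y p i = tabulate (λ v → ⌊ v ∈? Y ⌋ ∧ ⌊ p v ≟ i ⌋)

  crossing : Subset n → Subset m → ∀ {k} → (Fin n → Fin k) → Subset m
  crossing Y F p = tabulate (λ e →
    ⌊ e ∈? F ⌋ ∧ ⌊ proj₁ (ends G e) ∈? Y ⌋ ∧ ⌊ proj₂ (ends G e) ∈? Y ⌋
      ∧ not ⌊ p (proj₁ (ends G e)) ≟ p (proj₂ (ends G e)) ⌋)

  PartitionConnected : SetFn n → Subset n → Subset m → Set
  PartitionConnected l Y F =
    ∀ (k : ℕ) (p : Fin n → Fin k) → IsPartitionOf Y p →
      sumFin (λ i → l (part Y p i)) - l Y ≤ + ∣ crossing Y F p ∣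

  IsPCComponent : SetFn n → Subset m → Subset n → Set
  IsPCComponent l F Y =
    PartitionConnected l Y F ×
    (∀ Z → Y ⊆ Z → PartitionConnected l Z F → Z ≡ Y)

{-# OPTIONS --safe #-}
-- Call a partition P of V tight for H if e_H(P) = Σ_{A ∈ P} l(A) − l(V).  If H − e + e′ is not
-- l-partition-connected, some partition violates its inequality; as H satisfies it and the two graphs
-- differ only in e and e′, that partition is tight for H, e crosses it and e′ does not.
-- Supermodularity gives two closure properties of tight partitions: merging all parts that meet an
-- l-partition-connected set of H ∖ M keeps a tight partition tight and keeps every crossing M-edge
-- crossing; refining one part of a tight partition by another tight partition is again tight.
-- Starting from the trivial partition we keep a tight partition with a part A ⊇ Y₁ ∪ Y₂.  If no
-- M-edge lies inside A, tightness makes (H ∖ M)[A] l-partition-connected, contradicting the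
-- maximality of the components Y₁ ≠ Y₂.  Otherwise take an M-edge e inside A: either H − e + e′ is
-- l-partition-connected, or its violating partition, merged along Y₁ and then Y₂ (which puts both
-- ends of e′, hence Y₁ ∪ Y₂, into one part), refines A and strictly increases the number of crossing
-- edges of H, which is at most |E(G)|.
module Submission where

open import Defs
open import Data.Nat as ℕ using (ℕ; zero; suc)
open import Data.Integer as ℤ using (ℤ; 0ℤ; 1ℤ; +_; _+_; _≤_; _<_) renaming (_-_ to _-ℤ_)
import Data.Integer.Properties as ℤP
open import Data.Integer.Tactic.RingSolver using (solve-∀)
open import Algebra.Properties.CommutativeSemigroup ℤP.+-commutativeSemigroup using (interchange; x∙yz≈y∙xz; xy∙z≈xz∙y)
open import Data.Fin as F using (Fin; punchIn; punchOut; _↑ˡ_; _↑ʳ_)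
import Data.Fin.Properties as FP
import Data.Nat.Properties as NP
open import Data.Fin.Subset using (Subset; _∈_; _∉_; _⊆_; _─_; _-_; ⊥; ⊤; ⁅_⁆; Nonempty; inside; ∣_∣)
open import Data.Fin.Subset.Properties using (_∈?_)
open import Data.Bool using (Bool; true; false; _∧_; _∨_; not; if_then_else_)
import Data.Bool.Properties as BP
open import Data.Vec using (_∷_; lookup; tabulate; zipWith; _[_]≔_)
import Data.Vec.Properties as VP
open import Data.Product using (_×_; _,_; proj₁; proj₂; ∃; ∃₂; Σ)
open import Data.Sum using (_⊎_; inj₁; inj₂)
open import Data.Empty using (⊥-elim) renaming (⊥ to Empty)
open import Function using (_∘_; _∘₂_; case_of_)
open import Relation.Nullary using (Dec; yes; no; ¬_; does; contraposition)
open import Relation.Nullary.Decidable using (⌊_⌋; _×-dec_)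
open import Relation.Binary.PropositionalEquality

sumFin-cong : ∀ {k} {f g : Fin k → ℤ} → (∀ i → f i ≡ g i) → sumFin f ≡ sumFin g
sumFin-cong {zero}  f≗g = refl
sumFin-cong {suc k} f≗g = cong₂ _+_ (f≗g F.zero) (sumFin-cong (f≗g ∘ F.suc))

sumFin-zero : ∀ {k} {f : Fin k → ℤ} → (∀ i → f i ≡ 0ℤ) → sumFin f ≡ 0ℤ
sumFin-zero {zero}  f≗0 = refl
sumFin-zero {suc k} f≗0 = cong₂ _+_ (f≗0 F.zero) (sumFin-zero (f≗0 ∘ F.suc))

sumFin-+ : ∀ {k} (f g : Fin k → ℤ) → sumFin (λ i → f i + g i) ≡ sumFin f + sumFin g
sumFin-+ {zero}  f g = refl
sumFin-+ {suc k} f g =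
  trans (cong (_+_ (f F.zero + g F.zero)) (sumFin-+ (f ∘ F.suc) (g ∘ F.suc)))
        (interchange (f F.zero) (g F.zero) _ _)

sumFin-mono : ∀ {k} {f g : Fin k → ℤ} → (∀ i → f i ≤ g i) → sumFin f ≤ sumFin g
sumFin-mono {zero}  f≤g = ℤP.≤-refl
sumFin-mono {suc k} f≤g = ℤP.+-mono-≤ (f≤g F.zero) (sumFin-mono (f≤g ∘ F.suc))

sumFin-punchIn : ∀ {k} (a : Fin (suc k)) (f : Fin (suc k) → ℤ) →
                 sumFin f ≡ f a + sumFin (f ∘ punchIn a)
sumFin-punchIn F.zero    f = refl
sumFin-punchIn {suc k} (F.suc a) f =
  trans (cong (_+_ (f F.zero)) (sumFin-punchIn a (f ∘ F.suc)))
        (x∙yz≈y∙xz (f F.zero) (f (F.suc a)) _)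

sumFin-↑ : ∀ k {j} (f : Fin (k ℕ.+ j) → ℤ) →
           sumFin f ≡ sumFin (λ i → f (i ↑ˡ j)) + sumFin (λ i → f (k ↑ʳ i))
sumFin-↑ zero    f = sym (ℤP.+-identityˡ _)
sumFin-↑ (suc k) f =
  trans (cong (_+_ (f F.zero)) (sumFin-↑ k (f ∘ F.suc))) (sym (ℤP.+-assoc (f F.zero) _ _))

sumFin-< : ∀ {k} {f g : Fin k → ℤ} → (∀ i → f i ≤ g i) → ∀ a → f a < g a → sumFin f < sumFin g
sumFin-< {suc k} {f} {g} f≤g a fa<ga =
  subst₂ _<_ (sym (sumFin-punchIn a f)) (sym (sumFin-punchIn a g))
    (ℤP.+-mono-<-≤ fa<ga (sumFin-mono (f≤g ∘ punchIn a)))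

sumFin-≤1 : ∀ {k} {f : Fin k → ℤ} → (∀ i → f i ≤ 1ℤ) → sumFin f ≤ + k
sumFin-≤1 {zero}  f≤1 = ℤP.≤-refl
sumFin-≤1 {suc k} f≤1 = ℤP.+-mono-≤ (f≤1 F.zero) (sumFin-≤1 (f≤1 ∘ F.suc))

+-≤-cancelˡ : ∀ {a b c d} → a + b ≤ c + d → c ≤ a → b ≤ d
+-≤-cancelˡ {a} {b} {c} {d} ab≤cd c≤a = ℤP.0≤i-j⇒j≤i
  (subst (0ℤ ≤_) (slack a b c d) (ℤP.+-mono-≤ (ℤP.i≤j⇒0≤j-i ab≤cd) (ℤP.i≤j⇒0≤j-i c≤a)))
  where
  slack : ∀ a b c d → ((c + d) -ℤ (a + b)) + (a -ℤ c) ≡ d -ℤ b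
  slack = solve-∀

+-≤-cancelʳ : ∀ {a b c d} → a + b ≤ c + d → d ≤ b → a ≤ c
+-≤-cancelʳ {a} {b} {c} {d} ab≤cd =
  +-≤-cancelˡ (subst₂ _≤_ (ℤP.+-comm a b) (ℤP.+-comm c d) ab≤cd)

+-≤-transpose : ∀ {a b c d} → a + b ≤ c + d → b -ℤ d ≤ c -ℤ a
+-≤-transpose {a} {b} {c} {d} ab≤cd = ℤP.0≤i-j⇒j≤i
  (subst (0ℤ ≤_) (slack a b c d) (ℤP.i≤j⇒0≤j-i ab≤cd))
  where
  slack : ∀ a b c d → (c + d) -ℤ (a + b) ≡ (c -ℤ a) -ℤ (b -ℤ d)
  slack = solve-∀

-‿regroup : ∀ {x y z w} e → x + y ≡ z + w → x -ℤ e ≡ (z -ℤ e) + (w -ℤ y)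
-‿regroup {x} {y} {z} {w} e xy≡zw = begin
  x -ℤ e                      ≡⟨ cancel x y e ⟩
  (x + y) -ℤ (y + e)          ≡⟨ cong (_-ℤ (y + e)) xy≡zw ⟩
  (z + w) -ℤ (y + e)          ≡⟨ regroup z w y e ⟩
  (z -ℤ e) + (w -ℤ y)         ∎
  where
  open ≡-Reasoning
  cancel : ∀ x y e → x -ℤ e ≡ (x + y) -ℤ (y + e)
  cancel = solve-∀
  regroup : ∀ z w y e → (z + w) -ℤ (y + e) ≡ (z -ℤ e) + (w -ℤ y)
  regroup = solve-∀

+-≡-<-cancel : ∀ {a b c d} → a + b ≡ c + d → a < c → d < b
+-≡-<-cancel {a} {b} {c} {d} eq a<c = ℤP.≰⇒> λ b≤d →
  ℤP.<-irrefl eq (ℤP.+-mono-<-≤ a<c b≤d)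

≢-not : ∀ {b c d : Bool} → c ≡ b → d ≡ not b → c ≢ d
≢-not refl refl = BP.not-¬ refl

ι : Bool → ℤ
ι true  = 1ℤ
ι false = 0ℤ

ι-nonneg : ∀ b → 0ℤ ≤ ι b
ι-nonneg true  = ℤ.+≤+ ℕ.z≤n
ι-nonneg false = ℤ.+≤+ ℕ.z≤n

ι≤1 : ∀ b → ι b ≤ 1ℤ
ι≤1 true  = ℤP.≤-refl
ι≤1 false = ℤ.+≤+ ℕ.z≤n

ι-mono : ∀ {b c} → (b ≡ true → c ≡ true) → ι b ≤ ι c
ι-mono {false} {c} b⇒c = ι-nonneg c
ι-mono {true}  {c} b⇒c rewrite b⇒c refl = ℤP.≤-refl

ι-< : ∀ {b c} → ι b < ι c → b ≡ false × c ≡ true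
ι-< {false} {true} _ = refl , refl
ι-< {false} {false} (ℤ.+<+ ())
ι-< {true}  {false} (ℤ.+<+ ())
ι-< {true}  {true}  (ℤ.+<+ (ℕ.s≤s ()))

ι-false<true : ι false < ι true
ι-false<true = ℤ.+<+ (ℕ.s≤s ℕ.z≤n)

ι-split : ∀ {a b c} → ι a ≡ ι b + ι c → a ≡ true → b ≡ false → c ≡ true
ι-split {c = true}  _  _    _    = refl
ι-split {c = false} eq refl refl with eq
... | ()

count-tabulate : ∀ {k} (f : Fin k → Bool) → + ∣ tabulate f ∣ ≡ sumFin (ι ∘ f)
count-tabulate {zero}  f = refl
count-tabulate {suc k} f with f F.zero
... | true  = cong (_+_ 1ℤ) (count-tabulate (f ∘ F.suc))
... | false = trans (count-tabulate (f ∘ F.suc)) (sym (ℤP.+-identityˡ _))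

all⊎any : ∀ {k} {A B : Fin k → Set} → (∀ a → A a ⊎ B a) → (∀ a → A a) ⊎ ∃ B
all⊎any {zero}  A⊎B = inj₁ (λ ())
all⊎any {suc k} A⊎B with A⊎B F.zero | all⊎any (A⊎B ∘ F.suc)
... | inj₂ b | _           = inj₂ (F.zero , b)
... | inj₁ a | inj₁ as     = inj₁ λ { F.zero → a ; (F.suc i) → as i }
... | inj₁ a | inj₂ (i , b) = inj₂ (F.suc i , b)

all⊎counterexample : ∀ N {K} (P : (Fin N → Fin K) → Set) →
  (∀ {f g} → (∀ x → f x ≡ g x) → P f → P g) → (∀ f → Dec (P f)) →
  (∀ f → P f) ⊎ ∃ λ f → ¬ P f
all⊎counterexample zero P resp P? with P? (λ ())
... | yes p = inj₁ λ f → resp (λ ()) p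
... | no ¬p = inj₂ ((λ ()) , ¬p)
all⊎counterexample (suc N) {K} P resp P?
  with all⊎any {K} (λ a → all⊎counterexample N (P ∘ cons a) (λ f≗g → resp (cons-cong a f≗g)) (P? ∘ cons a))
  where
  cons : Fin K → (Fin N → Fin K) → Fin (suc N) → Fin K
  cons a f F.zero    = a
  cons a f (F.suc x) = f x
  cons-cong : ∀ a {f g} → (∀ x → f x ≡ g x) → ∀ x → cons a f x ≡ cons a g x
  cons-cong a f≗g F.zero    = refl
  cons-cong a f≗g (F.suc x) = f≗g x
... | inj₁ all = inj₁ λ f → resp (λ { F.zero → refl ; (F.suc x) → refl }) (all (f F.zero) (f ∘ F.suc))
... | inj₂ (a , f , ¬p) = inj₂ (_ , ¬p)

zipWith-tabulate : ∀ {A B C : Set} {k} (f : A → B → C) (g : Fin k → A) (h : Fin k → B) →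
                   zipWith f (tabulate g) (tabulate h) ≡ tabulate (λ i → f (g i) (h i))
zipWith-tabulate {k = zero}  f g h = refl
zipWith-tabulate {k = suc k} f g h = cong (f (g F.zero) (h F.zero) ∷_) (zipWith-tabulate f (g ∘ F.suc) (h ∘ F.suc))

∈-tabulate : ∀ {k} {f : Fin k → Bool} {v} → f v ≡ true → v ∈ tabulate f
∈-tabulate {f = f} {v} fv = VP.lookup⇒[]= v (tabulate f) (trans (VP.lookup∘tabulate f v) fv)

_≐_ : ∀ {k} → Fin k → Fin k → Bool
i ≐ j = ⌊ i FP.≟ j ⌋

≐-refl : ∀ {k} (i : Fin k) → i ≐ i ≡ true
≐-refl i with i FP.≟ i
... | yes _   = refl
... | no  i≢i = ⊥-elim (i≢i refl)

≡⇒≐ : ∀ {k} {i j : Fin k} → i ≡ j → i ≐ j ≡ true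
≡⇒≐ {i = i} refl = ≐-refl i

≢⇒≐ : ∀ {k} {i j : Fin k} → i ≢ j → i ≐ j ≡ false
≢⇒≐ {i = i} {j} i≢j with i FP.≟ j
... | yes i≡j = ⊥-elim (i≢j i≡j)
... | no  _   = refl

≐⇒≡ : ∀ {k} {i j : Fin k} → i ≐ j ≡ true → i ≡ j
≐⇒≡ {i = i} {j} i≐j with i FP.≟ j
... | yes i≡j = i≡j

≐-cong : ∀ {k k′} {i j : Fin k} {i′ j′ : Fin k′} →
         (i ≡ j → i′ ≡ j′) → (i′ ≡ j′ → i ≡ j) → i ≐ j ≡ i′ ≐ j′
≐-cong {i = i} {j} {i′} {j′} to from with i FP.≟ j | i′ FP.≟ j′
... | yes _    | yes _     = refl
... | no  _    | no  _     = refl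
... | yes i≡j  | no  i′≢j′ = ⊥-elim (i′≢j′ (to i≡j))
... | no  i≢j  | yes i′≡j′ = ⊥-elim (i≢j (from i′≡j′))

≐-suc : ∀ {k} (i j : Fin k) → F.suc i ≐ F.suc j ≡ i ≐ j
≐-suc i j = ≐-cong FP.suc-injective (cong F.suc)

sumFin-ι-≐ : ∀ {k} (a : Fin k) (c : Fin k → Bool) → sumFin (λ x → ι ((x ≐ a) ∧ c x)) ≡ ι (c a)
sumFin-ι-≐ {suc k} a c = begin
  sumFin (λ x → ι ((x ≐ a) ∧ c x))
    ≡⟨ sumFin-punchIn a (λ x → ι ((x ≐ a) ∧ c x)) ⟩
  ι ((a ≐ a) ∧ c a) + sumFin (λ x → ι ((punchIn a x ≐ a) ∧ c (punchIn a x)))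
    ≡⟨ cong₂ _+_ (cong (λ b → ι (b ∧ c a)) (≐-refl a))
                 (sumFin-zero λ x → cong (λ b → ι (b ∧ c (punchIn a x))) (≢⇒≐ (FP.punchInᵢ≢i a x))) ⟩
  ι (c a) + 0ℤ
    ≡⟨ ℤP.+-identityʳ (ι (c a)) ⟩
  ι (c a)
    ∎
  where open ≡-Reasoning

∈?-lookup : ∀ {k} (v : Fin k) (Y : Subset k) → ⌊ v ∈? Y ⌋ ≡ lookup Y v
∈?-lookup v Y with v ∈? Y
... | yes v∈Y = sym (VP.[]=⇒lookup v∈Y)
... | no  v∉Y with lookup Y v in eq
...   | true  = ⊥-elim (v∉Y (VP.lookup⇒[]= v Y eq))
...   | false = refl

lookup-─ : ∀ {k} (A B : Subset k) x → lookup (A ─ B) x ≡ lookup A x ∧ not (lookup B x)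
lookup-─ (a ∷ A) (true  ∷ B) F.zero    = sym (BP.∧-zeroʳ a)
lookup-─ (a ∷ A) (false ∷ B) F.zero    = sym (BP.∧-identityʳ a)
lookup-─ (a ∷ A) (b ∷ B)     (F.suc x) = lookup-─ A B x

lookup-⁅⁆ : ∀ {k} (e x : Fin k) → lookup ⁅ e ⁆ x ≡ x ≐ e
lookup-⁅⁆ F.zero    F.zero    = refl
lookup-⁅⁆ F.zero    (F.suc x) = VP.lookup-replicate x false
lookup-⁅⁆ (F.suc e) F.zero    = refl
lookup-⁅⁆ (F.suc e) (F.suc x) = trans (lookup-⁅⁆ e x) (sym (≐-suc x e))

module _ {k} (Y : Subset k) {e e′ : Fin k} where

  lookup-swap-new : lookup ((Y - e) [ e′ ]≔ inside) e′ ≡ true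
  lookup-swap-new = VP.lookup∘update e′ (Y - e) inside

  lookup-swap-other : ∀ {x} → x ≢ e → x ≢ e′ → lookup ((Y - e) [ e′ ]≔ inside) x ≡ lookup Y x
  lookup-swap-other {x} x≢e x≢e′ = begin
    lookup ((Y - e) [ e′ ]≔ inside) x   ≡⟨ VP.lookup∘update′ x≢e′ (Y - e) inside ⟩
    lookup (Y ─ ⁅ e ⁆) x                ≡⟨ lookup-─ Y ⁅ e ⁆ x ⟩
    lookup Y x ∧ not (lookup ⁅ e ⁆ x)   ≡⟨ cong (λ b → lookup Y x ∧ not b) (lookup-⁅⁆ e x) ⟩
    lookup Y x ∧ not (x ≐ e)            ≡⟨ cong (λ b → lookup Y x ∧ not b) (≢⇒≐ x≢e) ⟩
    lookup Y x ∧ true                   ≡⟨ BP.∧-identityʳ (lookup Y x) ⟩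
    lookup Y x                          ∎
    where open ≡-Reasoning

  lookup-swap-old : e ≢ e′ → lookup ((Y - e) [ e′ ]≔ inside) e ≡ false
  lookup-swap-old e≢e′ = begin
    lookup ((Y - e) [ e′ ]≔ inside) e   ≡⟨ VP.lookup∘update′ e≢e′ (Y - e) inside ⟩
    lookup (Y ─ ⁅ e ⁆) e                ≡⟨ lookup-─ Y ⁅ e ⁆ e ⟩
    lookup Y e ∧ not (lookup ⁅ e ⁆ e)   ≡⟨ cong (λ b → lookup Y e ∧ not b) (lookup-⁅⁆ e e) ⟩
    lookup Y e ∧ not (e ≐ e)            ≡⟨ cong (λ b → lookup Y e ∧ not b) (≐-refl e) ⟩
    lookup Y e ∧ false                  ≡⟨ BP.∧-zeroʳ (lookup Y e) ⟩
    false                               ∎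
    where open ≡-Reasoning

-- Labellings of the vertex set

↑ˡ≢↑ʳ : ∀ {k j} (i : Fin k) (t : Fin j) → i ↑ˡ j ≢ k ↑ʳ t
↑ˡ≢↑ʳ {k} {j} i t eq with trans (sym (FP.splitAt-↑ˡ k i j)) (trans (cong (F.splitAt k) eq) (FP.splitAt-↑ʳ k j t))
... | ()

dropLabel : ∀ {k} (i x : Fin (suc (suc k))) → Fin (suc k)
dropLabel i x with x FP.≟ i
... | yes _   = F.zero
... | no  x≢i = punchOut (x≢i ∘ sym)

dropLabel-≐-punchIn : ∀ {k} {i x : Fin (suc (suc k))} → x ≢ i → ∀ j → dropLabel i x ≐ j ≡ x ≐ punchIn i j
dropLabel-≐-punchIn {i = i} {x} x≢i j with x FP.≟ i
... | yes x≡i = ⊥-elim (x≢i x≡i)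
... | no  _   = ≐-cong (λ eq → trans (sym (FP.punchIn-punchOut _)) (cong (punchIn i) eq))
                       (λ eq → trans (FP.punchOut-cong i eq) (FP.punchOut-punchIn i))

dropLabel-≐ : ∀ {k} {i x z : Fin (suc (suc k))} → x ≢ i → z ≢ i → dropLabel i x ≐ dropLabel i z ≡ x ≐ z
dropLabel-≐ {i = i} {x} {z} x≢i z≢i with x FP.≟ i | z FP.≟ i
... | yes x≡i | _       = ⊥-elim (x≢i x≡i)
... | no  _   | yes z≡i = ⊥-elim (z≢i z≡i)
... | no  x≢i′ | no  z≢i′ = ≐-cong (FP.punchOut-injective (x≢i′ ∘ sym) (z≢i′ ∘ sym)) (FP.punchOut-cong i)

VPred : ℕ → Set
VPred n = Fin n → Bool

module _ {n : ℕ} where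

  _∧ᵖ_ _∨ᵖ_ : VPred n → VPred n → VPred n
  (X ∧ᵖ Y) v = X v ∧ Y v
  (X ∨ᵖ Y) v = X v ∨ Y v

  _⊆ᵖ_ : VPred n → VPred n → Set
  X ⊆ᵖ Y = ∀ v → X v ≡ true → Y v ≡ true

  ⊆ᵖ-antisym : ∀ {X Y} → X ⊆ᵖ Y → Y ⊆ᵖ X → ∀ v → X v ≡ Y v
  ⊆ᵖ-antisym {X} {Y} X⊆Y Y⊆X v with X v in xv | Y v in yv
  ... | true  | true  = refl
  ... | false | false = refl
  ... | true  | false = trans (sym (X⊆Y v xv)) yv
  ... | false | true  = trans (sym xv) (Y⊆X v yv)

  Meets : VPred n → VPred n → Set
  Meets X Y = ∃ λ v → (X ∧ᵖ Y) v ≡ true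

  meets? : ∀ X Y → Dec (Meets X Y)
  meets? X Y = FP.any? (λ v → (X ∧ᵖ Y) v BP.≟ true)

  Meets-resp : ∀ {X X′ Y} → (∀ v → (X ∧ᵖ Y) v ≡ (X′ ∧ᵖ Y) v) → Meets X Y → Meets X′ Y
  Meets-resp eq (v , XYv) = v , trans (sym (eq v)) XYv

  ¬Meets⇒∧≡false : ∀ {X Y} → ¬ Meets X Y → ∀ v → (X ∧ᵖ Y) v ≡ false
  ¬Meets⇒∧≡false {X} {Y} ¬XY v with (X ∧ᵖ Y) v in XYv
  ... | true  = ⊥-elim (¬XY (v , XYv))
  ... | false = refl

  ∨-∧-disjoint : ∀ {X Q Y} → (∀ v → (Q ∧ᵖ Y) v ≡ false) → ∀ v → ((X ∨ᵖ Q) ∧ᵖ Y) v ≡ (X ∧ᵖ Y) v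
  ∨-∧-disjoint {X} {Q} {Y} QY≗∅ v =
    trans (BP.∧-distribʳ-∨ (Y v) (X v) (Q v)) (trans (cong (X v ∧ Y v ∨_) (QY≗∅ v)) (BP.∨-identityʳ _))

  class : ∀ {k} → (Fin n → Fin k) → Fin k → VPred n
  class p i v = p v ≐ i

  class-disjoint : ∀ {k} (p : Fin n → Fin k) {i i′ v} → class p i v ≡ true → class p i′ v ≡ true → i ≡ i′
  class-disjoint p pv≐i pv≐i′ = trans (sym (≐⇒≡ pv≐i)) (≐⇒≡ pv≐i′)

  full : VPred n
  full _ = true

  Saturated : ∀ {k} → VPred n → (Fin n → Fin k) → Set
  Saturated Y q = ∀ {v w} → q v ≡ q w → Y v ≡ Y w

  merged : ∀ {k} → VPred n → (Fin n → Fin k) → VPred n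
  merged X q v = does (meets? X (class q (q v)))

  module _ {k} (X : VPred n) (q : Fin n → Fin k) where

    merged-intro : ∀ {v} → Meets X (class q (q v)) → merged X q v ≡ true
    merged-intro {v} Xq with meets? X (class q (q v))
    ... | yes _   = refl
    ... | no ¬Xq  = ⊥-elim (¬Xq Xq)

    merged-elim : ∀ {v} → merged X q v ≡ true → Meets X (class q (q v))
    merged-elim {v} _ with meets? X (class q (q v))
    ... | yes Xq = Xq

    merged-resp : ∀ {v w} → q v ≡ q w → merged X q v ≡ merged X q w
    merged-resp qv≡qw = cong (λ i → does (meets? X (class q i))) qv≡qw

    ⊆merged : X ⊆ᵖ merged X q
    ⊆merged v Xv = merged-intro (v , trans (cong (_∧ (q v ≐ q v)) Xv) (≐-refl (q v)))

    class⊆merged : ∀ i → Meets X (class q i) → class q i ⊆ᵖ merged X q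
    class⊆merged i Xqᵢ v qv≐i = merged-intro (subst (Meets X ∘ class q) (sym (≐⇒≡ qv≐i)) Xqᵢ)

  merge : ∀ {k} → VPred n → (Fin n → Fin k) → Fin n → Fin (suc k)
  merge X q v = if merged X q v then F.zero else F.suc (q v)

  module _ {k} (X : VPred n) (q : Fin n → Fin k) where

    private
      M = merged X q

    merge-merged : ∀ {v} → M v ≡ true → merge X q v ≡ F.zero
    merge-merged {v} Mv = cong (if_then F.zero else F.suc (q v)) Mv

    class-merge-zero : ∀ v → class (merge X q) F.zero v ≡ M v
    class-merge-zero v with M v
    ... | true  = refl
    ... | false = refl

    class-merge-suc : ∀ i v → class (merge X q) (F.suc i) v ≡ ((not ∘ M) ∧ᵖ class q i) v
    class-merge-suc i v with M v
    ... | true  = refl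
    ... | false = ≐-suc (q v) i


  refine : ∀ {k j} → (Fin n → Fin k) → Fin k → (Fin n → Fin j) → Fin n → Fin (k ℕ.+ j)
  refine {k = k} {j} p a q v = if p v ≐ a then k ↑ʳ q v else p v ↑ˡ j

  module _ {k j} (p : Fin n → Fin (suc k)) (a : Fin (suc k)) (q : Fin n → Fin j) where

    private
      A = class p a

    class-refine-↑ˡ : ∀ i v → class (refine p a q) (i ↑ˡ j) v ≡ ((not ∘ A) ∧ᵖ class p i) v
    class-refine-↑ˡ i v with p v ≐ a
    ... | true  = ≢⇒≐ (↑ˡ≢↑ʳ i (q v) ∘ sym)
    ... | false = ≐-cong (FP.↑ˡ-injective j (p v) i) (cong (_↑ˡ j))

    class-refine-↑ʳ : ∀ t v → class (refine p a q) (suc k ↑ʳ t) v ≡ (A ∧ᵖ class q t) v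
    class-refine-↑ʳ t v with p v ≐ a
    ... | true  = ≐-cong (FP.↑ʳ-injective (suc k) (q v) t) (cong (suc k ↑ʳ_))
    ... | false = ≢⇒≐ (↑ˡ≢↑ʳ (p v) t)


-- The set function on vertex predicates

module SetFunction {n : ℕ} (l : SetFn n) (l⊥ : l ⊥ ≡ 0ℤ) (sup : IntersectingSupermodular l) where

  L : VPred n → ℤ
  L y = l (tabulate y)

  L-cong : ∀ {X Y} → (∀ v → X v ≡ Y v) → L X ≡ L Y
  L-cong X≗Y = cong l (VP.tabulate-cong X≗Y)

  L-empty : ∀ {X} → (∀ v → X v ≡ false) → L X ≡ 0ℤ
  L-empty {X} X≗∅ = trans (cong l (tabulate-≗-lookup X≗∅)) l⊥
    where
    tabulate-≗-lookup : (∀ v → X v ≡ false) → tabulate X ≡ ⊥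
    tabulate-≗-lookup X≗∅ = trans (VP.tabulate-cong λ v → trans (X≗∅ v) (sym (VP.lookup-replicate v false)))
                                  (VP.tabulate∘lookup ⊥)

  L-supermodular : ∀ {X Y} → Meets X Y → L X + L Y ≤ L (X ∧ᵖ Y) + L (X ∨ᵖ Y)
  L-supermodular {X} {Y} (v , XYv) =
    subst₂ (λ A B → L X + L Y ≤ l A + l B) (zipWith-tabulate _∧_ X Y) (zipWith-tabulate _∨_ X Y)
      (sup (tabulate X) (tabulate Y) (v , subst (v ∈_) (sym (zipWith-tabulate _∧_ X Y)) (∈-tabulate XYv)))

  lMeeting : VPred n → VPred n → ℤ
  lMeeting X Y with meets? X Y
  ... | yes _ = L Y
  ... | no  _ = 0ℤ

  lMeeting-resp : ∀ {X X′ Y} → (∀ v → (X ∧ᵖ Y) v ≡ (X′ ∧ᵖ Y) v) → lMeeting X Y ≡ lMeeting X′ Y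
  lMeeting-resp {X} {X′} {Y} eq with meets? X Y | meets? X′ Y
  ... | yes _  | yes _    = refl
  ... | no  _  | no  _    = refl
  ... | yes XY | no ¬X′Y  = ⊥-elim (¬X′Y (Meets-resp {X = X} {X′ = X′} {Y = Y} eq XY))
  ... | no ¬XY | yes X′Y  = ⊥-elim (¬XY (Meets-resp {X = X′} {X′ = X} {Y = Y} (sym ∘ eq) X′Y))

  -- The parts Q i meeting X are added to X one at a time, each step being one use of supermodularity.
  supermodular-chain : ∀ {j} (Q : Fin j → VPred n) → (∀ {i i′ v} → Q i v ≡ true → Q i′ v ≡ true → i ≡ i′) →
    (X Z : VPred n) → X ⊆ᵖ Z → (∀ i → Meets X (Q i) → Q i ⊆ᵖ Z) →
    (∀ v → Z v ≡ true → X v ≡ true ⊎ ∃ λ i → Meets X (Q i) × Q i v ≡ true) →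
    L X + sumFin (λ i → lMeeting X (Q i)) ≤ sumFin (λ i → L (X ∧ᵖ Q i)) + L Z
  supermodular-chain {zero} Q disj X Z X⊆Z Q⊆Z Z⊆ =
    ℤP.≤-reflexive (trans (ℤP.+-identityʳ (L X)) (trans (L-cong (⊆ᵖ-antisym X⊆Z Z⊆X)) (sym (ℤP.+-identityˡ (L Z)))))
    where
    Z⊆X : Z ⊆ᵖ X
    Z⊆X v Zv with Z⊆ v Zv
    ... | inj₁ Xv = Xv
  supermodular-chain {suc j} Q disj X Z X⊆Z Q⊆Z Z⊆ with meets? X (Q F.zero)
  ... | yes XQ₀ = begin
    L X + (L Q₀ + Σmeet)              ≡⟨ ℤP.+-assoc (L X) (L Q₀) Σmeet ⟨
    (L X + L Q₀) + Σmeet              ≤⟨ ℤP.+-monoˡ-≤ Σmeet (L-supermodular {X} {Q₀} XQ₀) ⟩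
    (L (X ∧ᵖ Q₀) + L X′) + Σmeet      ≡⟨ ℤP.+-assoc (L (X ∧ᵖ Q₀)) (L X′) Σmeet ⟩
    L (X ∧ᵖ Q₀) + (L X′ + Σmeet)      ≤⟨ ℤP.+-monoʳ-≤ (L (X ∧ᵖ Q₀)) ih ⟩
    L (X ∧ᵖ Q₀) + (Σ∧ + L Z)       ≡⟨ ℤP.+-assoc (L (X ∧ᵖ Q₀)) Σ∧ (L Z) ⟨
    (L (X ∧ᵖ Q₀) + Σ∧) + L Z       ∎
    where
    open ℤP.≤-Reasoning
    Q₀ = Q F.zero
    X′ = X ∨ᵖ Q₀
    Σmeet = sumFin (λ i → lMeeting X (Q (F.suc i)))
    Σ∧ = sumFin (λ i → L (X ∧ᵖ Q (F.suc i)))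
    Q₀-disjoint : ∀ i v → (Q F.zero ∧ᵖ Q (F.suc i)) v ≡ false
    Q₀-disjoint i v with Q F.zero v in q₀ | Q (F.suc i) v in qᵢ
    ... | true  | true  = case disj q₀ qᵢ of λ ()
    ... | true  | false = refl
    ... | false | _     = refl
    drop-Q₀ : ∀ i v → (X′ ∧ᵖ Q (F.suc i)) v ≡ (X ∧ᵖ Q (F.suc i)) v
    drop-Q₀ i = ∨-∧-disjoint {X = X} {Q = Q F.zero} {Y = Q (F.suc i)} (Q₀-disjoint i)
    X′⊆Z : X′ ⊆ᵖ Z
    X′⊆Z v X′v with X v in Xv
    ... | true  = X⊆Z v Xv
    ... | false = Q⊆Z F.zero XQ₀ v X′v
    Z⊆′ : ∀ v → Z v ≡ true → X′ v ≡ true ⊎ ∃ λ i → Meets X′ (Q (F.suc i)) × Q (F.suc i) v ≡ true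
    Z⊆′ v Zv with Z⊆ v Zv
    ... | inj₁ Xv                   = inj₁ (cong (_∨ Q F.zero v) Xv)
    ... | inj₂ (F.zero , _ , Q₀v)   = inj₁ (trans (cong (X v ∨_) Q₀v) (BP.∨-zeroʳ (X v)))
    ... | inj₂ (F.suc i , XQ , Qv)  =
      inj₂ (i , Meets-resp {X = X} {X′ = X′} (sym ∘ drop-Q₀ i) XQ , Qv)
    ih : L X′ + Σmeet ≤ Σ∧ + L Z
    ih = subst₂ (λ s t → L X′ + s ≤ t + L Z)
           (sumFin-cong λ i → lMeeting-resp {X′} {X} {Q (F.suc i)} (drop-Q₀ i))
           (sumFin-cong λ i → L-cong (drop-Q₀ i))
           (supermodular-chain (Q ∘ F.suc) (FP.suc-injective ∘₂ disj) X′ Z X′⊆Z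
             (λ i X′Q → Q⊆Z (F.suc i) (Meets-resp {X = X′} {X′ = X} (drop-Q₀ i) X′Q)) Z⊆′)
  ... | no ¬XQ₀ = begin
    L X + (0ℤ + Σmeet)               ≡⟨ cong (_+_ (L X)) (ℤP.+-identityˡ Σmeet) ⟩
    L X + Σmeet                      ≤⟨ ih ⟩
    Σ∧ + L Z                         ≡⟨ cong (_+ L Z) (ℤP.+-identityˡ Σ∧) ⟨
    (0ℤ + Σ∧) + L Z                  ≡⟨ cong (λ t → (t + Σ∧) + L Z) (L-empty {X ∧ᵖ Q F.zero} X∧Q₀≗∅) ⟨
    (L (X ∧ᵖ Q F.zero) + Σ∧) + L Z   ∎
    where
    open ℤP.≤-Reasoning
    X∧Q₀≗∅ = ¬Meets⇒∧≡false {X = X} {Y = Q F.zero} ¬XQ₀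
    Σmeet = sumFin (λ i → lMeeting X (Q (F.suc i)))
    Σ∧ = sumFin (λ i → L (X ∧ᵖ Q (F.suc i)))
    Z⊆′ : ∀ v → Z v ≡ true → X v ≡ true ⊎ ∃ λ i → Meets X (Q (F.suc i)) × Q (F.suc i) v ≡ true
    Z⊆′ v Zv with Z⊆ v Zv
    ... | inj₁ Xv                  = inj₁ Xv
    ... | inj₂ (F.zero , XQ₀ , _)  = ⊥-elim (¬XQ₀ XQ₀)
    ... | inj₂ (F.suc i , XQ , Qv) = inj₂ (i , XQ , Qv)
    ih = supermodular-chain (Q ∘ F.suc) (FP.suc-injective ∘₂ disj) X Z X⊆Z (Q⊆Z ∘ F.suc) Z⊆′

  Σl : ∀ {k} → VPred n → (Fin n → Fin k) → ℤ
  Σl y p = sumFin (λ i → L (y ∧ᵖ class p i))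

  demand : ∀ {k} → VPred n → (Fin n → Fin k) → ℤ
  demand y p = Σl y p -ℤ L y

  demand-one-part : demand full (λ _ → F.zero {0}) ≡ 0ℤ
  demand-one-part = trans (cong (_-ℤ L full) (ℤP.+-identityʳ (L full))) (ℤP.+-inverseʳ (L full))

  module _ {k} (X : VPred n) (q : Fin n → Fin k) where

    L-merged∧class : ∀ i → L (merged X q ∧ᵖ class q i) ≡ lMeeting X (class q i)
    L-merged∧class i with meets? X (class q i)
    ... | yes Xqᵢ = L-cong pt
      where
      pt : ∀ v → merged X q v ∧ (q v ≐ i) ≡ (q v ≐ i)
      pt v with q v ≐ i in qv≐i
      ... | true  = trans (BP.∧-identityʳ _) (class⊆merged X q i Xqᵢ v qv≐i)
      ... | false = BP.∧-zeroʳ _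
    ... | no ¬Xqᵢ = L-empty pt
      where
      pt : ∀ v → merged X q v ∧ (q v ≐ i) ≡ false
      pt v with q v ≐ i in qv≐i | merged X q v in Mv
      ... | false | _     = BP.∧-zeroʳ _
      ... | true  | false = refl
      ... | true  | true  = ⊥-elim (¬Xqᵢ (subst (Meets X ∘ class q) (≐⇒≡ qv≐i) (merged-elim X q Mv)))

    demand-merged≤demand : demand (merged X q) q ≤ demand X q
    demand-merged≤demand =
      subst (λ t → t -ℤ L (merged X q) ≤ demand X q) (sym (sumFin-cong L-merged∧class))
        (+-≤-transpose {a = L X} {c = Σl X q}
          (supermodular-chain (class q) (class-disjoint q) X (merged X q) (⊆merged X q) (class⊆merged X q)
            λ v Mv → inj₂ (q v , merged-elim X q Mv , ≐-refl (q v))))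

  L-split : ∀ {k} {Y} {q : Fin n → Fin k} → Saturated Y q →
            ∀ i → L ((not ∘ Y) ∧ᵖ class q i) + L (Y ∧ᵖ class q i) ≡ L (class q i)
  L-split {Y = Y} {q} sat i with meets? Y (class q i)
  ... | yes (w , Yw∧qw≐i) =
    trans (cong₂ _+_ (L-empty off-Y) (L-cong on-Y)) (ℤP.+-identityˡ _)
    where
    Y-on-class : ∀ v → q v ≐ i ≡ true → Y v ≡ true
    Y-on-class v qv≐i =
      trans (sat (trans (≐⇒≡ qv≐i) (sym (≐⇒≡ (BP.∧-conicalʳ _ _ Yw∧qw≐i))))) (BP.∧-conicalˡ _ _ Yw∧qw≐i)
    off-Y : ∀ v → not (Y v) ∧ (q v ≐ i) ≡ false
    off-Y v with q v ≐ i in qv≐i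
    ... | true  = cong (λ b → not b ∧ true) (Y-on-class v qv≐i)
    ... | false = BP.∧-zeroʳ _
    on-Y : ∀ v → Y v ∧ (q v ≐ i) ≡ (q v ≐ i)
    on-Y v with q v ≐ i in qv≐i
    ... | true  = trans (BP.∧-identityʳ _) (Y-on-class v qv≐i)
    ... | false = BP.∧-zeroʳ _
  ... | no ¬Yqᵢ =
    trans (cong₂ _+_ (L-cong off-Y) (L-empty (¬Meets⇒∧≡false {X = Y} {Y = class q i} ¬Yqᵢ))) (ℤP.+-identityʳ _)
    where
    off-Y : ∀ v → not (Y v) ∧ (q v ≐ i) ≡ (q v ≐ i)
    off-Y v with q v ≐ i in qv≐i | Y v in Yv
    ... | false | _     = BP.∧-zeroʳ _
    ... | true  | false = refl
    ... | true  | true  = ⊥-elim (¬Yqᵢ (v , cong₂ _∧_ Yv qv≐i))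

  module _ {k} (X : VPred n) (q : Fin n → Fin k) where

    private
      M = merged X q

    Σl-merge : Σl full q + L M ≡ Σl full (merge X q) + Σl M q
    Σl-merge = begin
      Σl full q + L M
        ≡⟨ ℤP.+-comm (Σl full q) (L M) ⟩
      L M + Σl full q
        ≡⟨ cong (_+_ (L M)) (sumFin-cong (sym ∘ L-split (merged-resp X q))) ⟩
      L M + sumFin (λ i → L∁M i + L (M ∧ᵖ class q i))
        ≡⟨ cong (_+_ (L M)) (sumFin-+ L∁M (λ i → L (M ∧ᵖ class q i))) ⟩
      L M + (sumFin L∁M + Σl M q)
        ≡⟨ ℤP.+-assoc (L M) (sumFin L∁M) (Σl M q) ⟨
      (L M + sumFin L∁M) + Σl M q
        ≡⟨ cong (_+ Σl M q) (cong₂ _+_ (L-cong (class-merge-zero X q)) (sumFin-cong (L-cong ∘ class-merge-suc X q))) ⟨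
      Σl full (merge X q) + Σl M q
        ∎
      where
      open ≡-Reasoning
      L∁M : Fin k → ℤ
      L∁M i = L ((not ∘ M) ∧ᵖ class q i)

    demand-merge : demand full q ≡ demand full (merge X q) + demand M q
    demand-merge = -‿regroup {x = Σl full q} {z = Σl full (merge X q)} (L full) Σl-merge

  module _ {k j} (p : Fin n → Fin (suc k)) (a : Fin (suc k)) (q : Fin n → Fin j) where

    private
      A = class p a

    Σl-class : Σl A p ≡ L A
    Σl-class = begin
      Σl A p
        ≡⟨ sumFin-punchIn a (λ i → L (A ∧ᵖ class p i)) ⟩
      L (A ∧ᵖ A) + sumFin (λ i → L (A ∧ᵖ class p (punchIn a i)))
        ≡⟨ cong₂ _+_ (L-cong (λ v → BP.∧-idem (A v))) (sumFin-zero (λ i → L-empty (disjoint i))) ⟩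
      L A + 0ℤ
        ≡⟨ ℤP.+-identityʳ (L A) ⟩
      L A
        ∎
      where
      open ≡-Reasoning
      disjoint : ∀ i v → (A ∧ᵖ class p (punchIn a i)) v ≡ false
      disjoint i v with p v ≐ a in pv≐a
      ... | true  = ≢⇒≐ λ pv≡aᵢ → FP.punchInᵢ≢i a i (trans (sym pv≡aᵢ) (≐⇒≡ pv≐a))
      ... | false = refl

    Σl-refine : Σl full (refine p a q) + L A ≡ Σl full p + Σl A q
    Σl-refine = begin
      Σl full (refine p a q) + L A
        ≡⟨ cong (_+ L A) (sumFin-↑ (suc k) (L ∘ class (refine p a q))) ⟩
      (sumFin (λ i → L (class (refine p a q) (i ↑ˡ j))) + sumFin (λ t → L (class (refine p a q) (suc k ↑ʳ t)))) + L A
        ≡⟨ cong (_+ L A) (cong₂ _+_ (sumFin-cong (L-cong ∘ class-refine-↑ˡ p a q))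
                                    (sumFin-cong (L-cong ∘ class-refine-↑ʳ p a q))) ⟩
      (sumFin L∁A + Σl A q) + L A
        ≡⟨ xy∙z≈xz∙y (sumFin L∁A) (Σl A q) (L A) ⟩
      (sumFin L∁A + L A) + Σl A q
        ≡⟨ cong (λ t → (sumFin L∁A + t) + Σl A q) Σl-class ⟨
      (sumFin L∁A + Σl A p) + Σl A q
        ≡⟨ cong (_+ Σl A q) (sumFin-+ L∁A (λ i → L (A ∧ᵖ class p i))) ⟨
      sumFin (λ i → L∁A i + L (A ∧ᵖ class p i)) + Σl A q
        ≡⟨ cong (_+ Σl A q) (sumFin-cong (L-split (cong (_≐ a)))) ⟩
      Σl full p + Σl A q
        ∎
      where
      open ≡-Reasoning
      L∁A : Fin (suc k) → ℤ
      L∁A i = L ((not ∘ A) ∧ᵖ class p i)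

    demand-refine : demand full (refine p a q) ≡ demand full p + demand A q
    demand-refine = -‿regroup {x = Σl full (refine p a q)} {z = Σl full p} (L full) Σl-refine

-- Crossing edges

EPred : ℕ → Set
EPred m = Fin m → Bool

module Crossings {n m : ℕ} (G : Graph n m) where

  src tgt : Fin m → Fin n
  src e = proj₁ (ends G e)
  tgt e = proj₂ (ends G e)

  crosses : ∀ {k} → VPred n → EPred m → (Fin n → Fin k) → Fin m → Bool
  crosses y F p e = F e ∧ y (src e) ∧ y (tgt e) ∧ not (p (src e) ≐ p (tgt e))

  crossings : ∀ {k} → VPred n → EPred m → (Fin n → Fin k) → ℤ
  crossings y F p = sumFin (ι ∘ crosses y F p)

  crossings-nonneg : ∀ {k} y F (p : Fin n → Fin k) → 0ℤ ≤ crossings y F p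
  crossings-nonneg y F p =
    subst (_≤ crossings y F p) (sumFin-zero {m} {λ _ → 0ℤ} (λ _ → refl)) (sumFin-mono (ι-nonneg ∘ crosses y F p))

  crossings-pos : ∀ {k} y F (p : Fin n → Fin k) {e} → crosses y F p e ≡ true → 0ℤ < crossings y F p
  crossings-pos y F p {e} c = subst (_< crossings y F p) (sumFin-zero {m} {λ _ → 0ℤ} (λ _ → refl))
    (sumFin-< (ι-nonneg ∘ crosses y F p) e (subst (λ b → ι false < ι b) (sym c) ι-false<true))

  crossings≤m : ∀ {k} y F (p : Fin n → Fin k) → crossings y F p ≤ + m
  crossings≤m y F p = sumFin-≤1 (ι≤1 ∘ crosses y F p)

  crossings-constant : ∀ {k} F (i : Fin k) → crossings full F (λ _ → i) ≡ 0ℤ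
  crossings-constant F i = sumFin-zero λ e → cong ι (trans (cong (λ b → F e ∧ not b) (≐-refl i)) (BP.∧-zeroʳ (F e)))

  crossings-resp : ∀ {k} {y y′ : VPred n} {F F′ : EPred m} {p p′ : Fin n → Fin k} →
    (∀ v → y v ≡ y′ v) → (∀ e → F e ≡ F′ e) → (∀ v → p v ≡ p′ v) →
    crossings y F p ≡ crossings y′ F′ p′
  crossings-resp y≗y′ F≗F′ p≗p′ = sumFin-cong λ e →
    cong ι (cong₂ _∧_ (F≗F′ e) (cong₂ _∧_ (y≗y′ (src e)) (cong₂ _∧_ (y≗y′ (tgt e))
      (cong not (cong₂ _≐_ (p≗p′ (src e)) (p≗p′ (tgt e)))))))

  crosses-mono : ∀ {k} {y y′ : VPred n} {F F′ : EPred m} (p : Fin n → Fin k) → y ⊆ᵖ y′ → F ⊆ᵖ F′ →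
                 ∀ e → crosses y F p e ≡ true → crosses y′ F′ p e ≡ true
  crosses-mono {y = y} {y′} {F} {F′} p y⊆y′ F⊆F′ e c with F e in Fe | y (src e) in ys | y (tgt e) in yt
  ... | true  | true  | true  rewrite F⊆F′ e Fe | y⊆y′ (src e) ys | y⊆y′ (tgt e) yt = c
  ... | true  | true  | false = case c of λ ()
  ... | true  | false | _     = case c of λ ()
  ... | false | _     | _     = case c of λ ()

  crossings-mono : ∀ {k} {y y′ : VPred n} {F F′ : EPred m} (p : Fin n → Fin k) → y ⊆ᵖ y′ → F ⊆ᵖ F′ →
                   crossings y F p ≤ crossings y′ F′ p
  crossings-mono p y⊆y′ F⊆F′ = sumFin-mono λ e → ι-mono (crosses-mono p y⊆y′ F⊆F′ e)

  module _ {k} (X : VPred n) (q : Fin n → Fin k) where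

    private
      M = merged X q

    ι-merge : ∀ v w → ι (not (q v ≐ q w)) ≡
                      ι (not (merge X q v ≐ merge X q w)) + ι (M v ∧ M w ∧ not (q v ≐ q w))
    ι-merge v w with M v in Mv | M w in Mw
    ... | true  | true  = sym (ℤP.+-identityˡ _)
    ... | false | false = trans (cong (ι ∘ not) (sym (≐-suc (q v) (q w)))) (sym (ℤP.+-identityʳ _))
    ... | true  | false rewrite ≢⇒≐ (contraposition (merged-resp X q) (≢-not Mv Mw)) = refl
    ... | false | true  rewrite ≢⇒≐ (contraposition (merged-resp X q) (≢-not Mv Mw)) = refl

    ι-crosses-merge : ∀ F e → ι (crosses full F q e) ≡ ι (crosses full F (merge X q) e) + ι (crosses M F q e)
    ι-crosses-merge F e with F e
    ... | true  = ι-merge (src e) (tgt e)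
    ... | false = refl

    crossings-merge : ∀ F → crossings full F q ≡ crossings full F (merge X q) + crossings M F q
    crossings-merge F = trans (sumFin-cong (ι-crosses-merge F))
      (sumFin-+ (ι ∘ crosses full F (merge X q)) (ι ∘ crosses M F q))

    crosses-merge-split : ∀ F e → crosses full F q e ≡ true → crosses full F (merge X q) e ≡ false →
                          crosses M F q e ≡ true
    crosses-merge-split F e = ι-split (ι-crosses-merge F e)

  module _ {k j} (p : Fin n → Fin (suc k)) (a : Fin (suc k)) (q : Fin n → Fin j) where

    private
      A = class p a

    ι-refine : ∀ v w → ι (not (refine p a q v ≐ refine p a q w)) ≡
                       ι (not (p v ≐ p w)) + ι (A v ∧ A w ∧ not (q v ≐ q w))
    ι-refine v w with p v ≐ a in pv≐a | p w ≐ a in pw≐a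
    ... | true  | true  rewrite trans (≐⇒≡ pv≐a) (sym (≐⇒≡ pw≐a)) | ≐-refl (p w) =
      trans (cong (ι ∘ not) (≐-cong (FP.↑ʳ-injective (suc k) (q v) (q w)) (cong (suc k ↑ʳ_))))
            (sym (ℤP.+-identityˡ _))
    ... | true  | false
      rewrite ≢⇒≐ (↑ˡ≢↑ʳ (p w) (q v) ∘ sym) | ≢⇒≐ (contraposition (cong (_≐ a)) (≢-not pv≐a pw≐a)) = refl
    ... | false | true
      rewrite ≢⇒≐ (↑ˡ≢↑ʳ (p v) (q w)) | ≢⇒≐ (contraposition (cong (_≐ a)) (≢-not pv≐a pw≐a)) = refl
    ... | false | false =
      trans (cong (ι ∘ not) (≐-cong (FP.↑ˡ-injective j (p v) (p w)) (cong (_↑ˡ j)))) (sym (ℤP.+-identityʳ _))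

    crossings-refine : ∀ F → crossings full F (refine p a q) ≡ crossings full F p + crossings A F q
    crossings-refine F = trans (sumFin-cong pt) (sumFin-+ (ι ∘ crosses full F p) (ι ∘ crosses A F q))
      where
      pt : ∀ e → ι (crosses full F (refine p a q) e) ≡ ι (crosses full F p e) + ι (crosses A F q e)
      pt e with F e
      ... | true  = ι-refine (src e) (tgt e)
      ... | false = refl

    crossings-refine-< : ∀ F {e} → crosses full F q e ≡ true → A (src e) ≡ true → A (tgt e) ≡ true →
                         crossings full F p < crossings full F (refine p a q)
    crossings-refine-< F {e} crosses-q As At =
      subst₂ _<_ (ℤP.+-identityʳ (crossings full F p)) (sym (crossings-refine F))
        (ℤP.+-monoʳ-< (crossings full F p) (crossings-pos A F q crosses-inside))
      where
      crosses-inside : crosses A F q e ≡ true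
      crosses-inside = subst₂ (λ x y → F e ∧ x ∧ y ∧ not (q (src e) ≐ q (tgt e)) ≡ true) (sym As) (sym At) crosses-q

  crossings-swap : ∀ {k} (y : VPred n) (F F′ : EPred m) (p : Fin n → Fin k) {e e′ : Fin m} → e ≢ e′ →
    F′ e ≡ false → F e′ ≡ false → (∀ x → x ≢ e → x ≢ e′ → F′ x ≡ F x) →
    crossings y F′ p + ι (crosses y F p e) ≡ crossings y F p + ι (crosses y F′ p e′)
  crossings-swap y F F′ p {e} {e′} e≢e′ F′e Fe′ F′≗F = begin
    crossings y F′ p + ι (crosses y F p e)
      ≡⟨ cong (_+_ (crossings y F′ p)) (sumFin-ι-≐ e (crosses y F p)) ⟨
    crossings y F′ p + sumFin (λ x → ι ((x ≐ e) ∧ crosses y F p x))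
      ≡⟨ sumFin-+ (ι ∘ crosses y F′ p) (λ x → ι ((x ≐ e) ∧ crosses y F p x)) ⟨
    sumFin (λ x → ι (crosses y F′ p x) + ι ((x ≐ e) ∧ crosses y F p x))
      ≡⟨ sumFin-cong pt ⟩
    sumFin (λ x → ι (crosses y F p x) + ι ((x ≐ e′) ∧ crosses y F′ p x))
      ≡⟨ sumFin-+ (ι ∘ crosses y F p) (λ x → ι ((x ≐ e′) ∧ crosses y F′ p x)) ⟩
    crossings y F p + sumFin (λ x → ι ((x ≐ e′) ∧ crosses y F′ p x))
      ≡⟨ cong (_+_ (crossings y F p)) (sumFin-ι-≐ e′ (crosses y F′ p)) ⟩
    crossings y F p + ι (crosses y F′ p e′)
      ∎
    where
    open ≡-Reasoning
    pt : ∀ x → ι (crosses y F′ p x) + ι ((x ≐ e) ∧ crosses y F p x) ≡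
               ι (crosses y F p x) + ι ((x ≐ e′) ∧ crosses y F′ p x)
    pt x with x FP.≟ e | x FP.≟ e′
    ... | yes refl | yes refl = ⊥-elim (e≢e′ refl)
    ... | yes refl | no x≢e′ rewrite F′e = ℤP.+-comm 0ℤ (ι (crosses y F p x))
    ... | no x≢e   | yes refl rewrite Fe′ = ℤP.+-comm (ι (crosses y F′ p x)) 0ℤ
    ... | no x≢e   | no x≢e′ rewrite F′≗F x x≢e x≢e′ = refl

-- Partition-connectivity

module PartitionConnectivity {n m : ℕ} (G : Graph n m) (l : SetFn n) (l⊥ : l ⊥ ≡ 0ℤ) (sup : IntersectingSupermodular l) where

  open SetFunction l l⊥ sup
  open Crossings G

  -- Unlike in PartitionConnected the labelling need not be onto: empty classes cost l ∅ = 0.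
  PC : VPred n → EPred m → Set
  PC y F = ∀ k (p : Fin n → Fin k) → demand y p ≤ crossings y F p

  demand-resp : ∀ {k} {y y′ : VPred n} {p p′ : Fin n → Fin k} →
    (∀ v → y v ≡ y′ v) → (∀ v → p v ≡ p′ v) → demand y p ≡ demand y′ p′
  demand-resp y≗y′ p≗p′ = cong₂ _-ℤ_
    (sumFin-cong λ i → L-cong λ v → cong₂ _∧_ (y≗y′ v) (cong (_≐ i) (p≗p′ v))) (L-cong y≗y′)

  PC-resp : ∀ {y y′ : VPred n} {F F′ : EPred m} →
            (∀ v → y v ≡ y′ v) → (∀ e → F e ≡ F′ e) → PC y F → PC y′ F′
  PC-resp y≗y′ F≗F′ pc k p = subst₂ _≤_
    (demand-resp {p = p} {p′ = p} y≗y′ (λ _ → refl))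
    (crossings-resp {p = p} {p′ = p} y≗y′ F≗F′ (λ _ → refl))
    (pc k p)

  Onto : ∀ {k} → VPred n → (Fin n → Fin k) → Set
  Onto y p = ∀ i → ∃ λ v → y v ≡ true × p v ≡ i

  onto-or-gap : ∀ {k} (y : VPred n) (p : Fin n → Fin k) → Onto y p ⊎ ∃ λ i → ∀ v → y v ≡ true → p v ≢ i
  onto-or-gap y p = all⊎any hit?
    where
    hit? : ∀ i → (∃ λ v → y v ≡ true × p v ≡ i) ⊎ (∀ v → y v ≡ true → p v ≢ i)
    hit? i with FP.any? (λ v → (y v BP.≟ true) ×-dec (p v FP.≟ i))
    ... | yes hit = inj₁ hit
    ... | no ¬hit = inj₂ λ v yv pv≡i → ¬hit (v , yv , pv≡i)

  module _ {k} {y : VPred n} {p : Fin n → Fin (suc (suc k))} {i} (gap : ∀ v → y v ≡ true → p v ≢ i) where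

    demand-dropLabel : demand y p ≡ demand y (dropLabel i ∘ p)
    demand-dropLabel = cong (_-ℤ L y) (begin
      Σl y p
        ≡⟨ sumFin-punchIn i (λ j → L (y ∧ᵖ class p j)) ⟩
      L (y ∧ᵖ class p i) + sumFin (λ j → L (y ∧ᵖ class p (punchIn i j)))
        ≡⟨ cong₂ _+_ (L-empty unused) (sumFin-cong λ j → L-cong (relabel j)) ⟩
      0ℤ + Σl y (dropLabel i ∘ p)
        ≡⟨ ℤP.+-identityˡ _ ⟩
      Σl y (dropLabel i ∘ p)
        ∎)
      where
      open ≡-Reasoning
      unused : ∀ v → y v ∧ (p v ≐ i) ≡ false
      unused v with y v in yv
      ... | true  = ≢⇒≐ (gap v yv)
      ... | false = refl
      relabel : ∀ j v → y v ∧ (p v ≐ punchIn i j) ≡ y v ∧ (dropLabel i (p v) ≐ j)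
      relabel j v with y v in yv
      ... | true  = sym (dropLabel-≐-punchIn (gap v yv) j)
      ... | false = refl

    crossings-dropLabel : ∀ F → crossings y F p ≡ crossings y F (dropLabel i ∘ p)
    crossings-dropLabel F = sumFin-cong {f = ι ∘ crosses y F p} λ e → cong ι (pt e)
      where
      pt : ∀ e → crosses y F p e ≡ crosses y F (dropLabel i ∘ p) e
      pt e with y (src e) in ys | y (tgt e) in yt
      ... | true  | true  = cong (λ b → F e ∧ not b) (sym (dropLabel-≐ (gap _ ys) (gap _ yt)))
      ... | true  | false = refl
      ... | false | _     = refl

  PC-of-onto : ∀ {y F} → (∀ k (p : Fin n → Fin k) → Onto y p → demand y p ≤ crossings y F p) → PC y F
  PC-of-onto {y} ok k p with onto-or-gap y p
  ... | inj₁ onto = ok k p onto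
  PC-of-onto ok zero p | inj₂ (() , _)
  PC-of-onto {y} {F} ok (suc zero) p | inj₂ (F.zero , gap) =
    subst (_≤ crossings y F p) (sym demand≡0) (crossings-nonneg y F p)
    where
    only-label : ∀ (x : Fin 1) → x ≡ F.zero
    only-label F.zero = refl
    y≗∅ : ∀ v → y v ≡ false
    y≗∅ v with y v in yv
    ... | true  = ⊥-elim (gap v yv (only-label (p v)))
    ... | false = refl
    demand≡0 : demand y p ≡ 0ℤ
    demand≡0 = cong₂ (λ a b → (a + 0ℤ) -ℤ b) (L-empty λ v → cong (_∧ _) (y≗∅ v)) (L-empty y≗∅)
  PC-of-onto {y} {F} ok (suc (suc k)) p | inj₂ (i , gap) =
    subst₂ _≤_ (sym (demand-dropLabel gap)) (sym (crossings-dropLabel gap F)) (PC-of-onto {y} {F} ok (suc k) (dropLabel i ∘ p))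

  demand-frozen : ∀ (Y : Subset n) {k} (p : Fin n → Fin k) →
                  sumFin (λ i → l (part G Y p i)) -ℤ l Y ≡ demand (lookup Y) p
  demand-frozen Y p = cong₂ _-ℤ_
    (sumFin-cong λ i → cong l (VP.tabulate-cong λ v → cong (_∧ (p v ≐ i)) (∈?-lookup v Y)))
    (cong l (sym (VP.tabulate∘lookup Y)))

  crossings-frozen : ∀ (Y : Subset n) (F : Subset m) {k} (p : Fin n → Fin k) →
                     + ∣ crossing G Y F p ∣ ≡ crossings (lookup Y) (lookup F) p
  crossings-frozen Y F p = trans
    (cong (λ X → + ∣ X ∣) (VP.tabulate-cong λ e → cong₂ _∧_ (∈?-lookup e F)
      (cong₂ _∧_ (∈?-lookup (src e) Y) (cong (_∧ _) (∈?-lookup (tgt e) Y)))))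
    (count-tabulate (crosses (lookup Y) (lookup F) p))

  PC-of-frozen : ∀ {Y F} → PartitionConnected G l Y F → PC (lookup Y) (lookup F)
  PC-of-frozen {Y} {F} pc = PC-of-onto {lookup Y} {lookup F} λ k p onto →
    subst₂ _≤_ (demand-frozen Y p) (crossings-frozen Y F p)
      (pc k p λ i → let (v , Yv , pv≡i) = onto i in v , VP.lookup⇒[]= v Y Yv , pv≡i)

  frozen-of-PC : ∀ {Y F} → PC (lookup Y) (lookup F) → PartitionConnected G l Y F
  frozen-of-PC {Y} {F} pc k p _ = subst₂ _≤_ (sym (demand-frozen Y p)) (sym (crossings-frozen Y F p)) (pc k p)

  PC-full-of-frozen : ∀ {F} → PartitionConnected G l ⊤ F → PC full (lookup F)
  PC-full-of-frozen pc = PC-resp (λ v → VP.lookup-replicate v inside) (λ _ → refl) (PC-of-frozen pc)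

  frozen-of-PC-full : ∀ {F} → PC full (lookup F) → PartitionConnected G l ⊤ F
  frozen-of-PC-full pc = frozen-of-PC (PC-resp (λ v → sym (VP.lookup-replicate v inside)) (λ _ → refl) pc)

  module _ {H M : Subset m} where

    private
      R : EPred m
      R e = lookup H e ∧ not (lookup M e)

    component-PC : ∀ {Y} → IsPCComponent G l (H ─ M) Y → PC (lookup Y) R
    component-PC C = PC-resp (λ _ → refl) (lookup-─ H M) (PC-of-frozen (proj₁ C))

    components-separated : ∀ {Y₁ Y₂} → IsPCComponent G l (H ─ M) Y₁ → IsPCComponent G l (H ─ M) Y₂ → Y₁ ≢ Y₂ →
                           ∀ A → PC A R → lookup Y₁ ⊆ᵖ A → lookup Y₂ ⊆ᵖ A → Empty
    components-separated C₁ C₂ Y₁≢Y₂ A A-PC Y₁⊆A Y₂⊆A =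
      Y₁≢Y₂ (trans (sym (proj₂ C₁ _ (into Y₁⊆A) Z-PC)) (proj₂ C₂ _ (into Y₂⊆A) Z-PC))
      where
      Z-PC : PartitionConnected G l (tabulate A) (H ─ M)
      Z-PC = frozen-of-PC (PC-resp (sym ∘ VP.lookup∘tabulate A) (sym ∘ lookup-─ H M) A-PC)
      into : ∀ {Y} → lookup Y ⊆ᵖ A → Y ⊆ tabulate A
      into Y⊆A {x} x∈Y = ∈-tabulate (Y⊆A x (VP.[]=⇒lookup x∈Y))

  onto⇒≤n : ∀ {k y} {q : Fin n → Fin k} → Onto y q → k ℕ.≤ n
  onto⇒≤n {q = q} onto = FP.injective⇒≤ λ {i} {j} eq →
    trans (sym (proj₂ (proj₂ (onto i)))) (trans (cong q eq) (proj₂ (proj₂ (onto j))))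

  module _ (F : EPred m) where

    private
      Ok : ∀ {k} → (Fin n → Fin k) → Set
      Ok q = demand full q ≤ crossings full F q

      Ok-resp : ∀ {k} {q q′ : Fin n → Fin k} → (∀ v → q v ≡ q′ v) → Ok q → Ok q′
      Ok-resp q≗q′ = subst₂ _≤_ (demand-resp {y = full} {y′ = full} (λ _ → refl) q≗q′)
                                (crossings-resp {y = full} {y′ = full} {F = F} {F′ = F} (λ _ → refl) (λ _ → refl) q≗q′)

      few-labels-or-violation : ∀ b → (∀ k → k ℕ.< b → ∀ (q : Fin n → Fin k) → Ok q) ⊎ ∃₂ λ k (q : Fin n → Fin k) → ¬ Ok q
      few-labels-or-violation zero = inj₁ λ _ ()
      few-labels-or-violation (suc b)
        with few-labels-or-violation b | all⊎counterexample n Ok Ok-resp (λ q → demand full q ℤP.≤? crossings full F q)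
      ... | inj₂ bad   | _              = inj₂ bad
      ... | inj₁ _     | inj₂ (q , ¬ok) = inj₂ (b , q , ¬ok)
      ... | inj₁ below | inj₁ at        = inj₁ λ k k<1+b q → case NP.m<1+n⇒m<n∨m≡n k<1+b of λ where
        (inj₁ k<b)  → below k k<b q
        (inj₂ refl) → at q

    PC-or-violation : PC full F ⊎ ∃₂ λ k (q : Fin n → Fin k) → ¬ (demand full q ≤ crossings full F q)
    PC-or-violation with few-labels-or-violation (suc n)
    ... | inj₂ bad  = inj₂ bad
    ... | inj₁ good = inj₁ (PC-of-onto λ k q onto → good k (ℕ.s≤s (onto⇒≤n onto)) q)

  module Exchange (H M : EPred m) (H-PC : PC full H) where

    R : EPred m
    R e = H e ∧ not (M e)

    -- As H is l-partition-connected, this is equality in the partition inequality for H.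
    Tight : ∀ {k} → (Fin n → Fin k) → Set
    Tight p = crossings full H p ≤ demand full p

    R⊆H : R ⊆ᵖ H
    R⊆H e = BP.∧-conicalˡ (H e) (not (M e))

    module _ {k} (X : VPred n) (q : Fin n → Fin k) where

      private
        U = merged X q

      tight-merge-split : Tight q → crossings full H (merge X q) + crossings U H q ≤ demand full (merge X q) + demand U q
      tight-merge-split = subst₂ _≤_ (crossings-merge X q H) (demand-merge X q)

      crossings-merged≤demand : Tight q → crossings U H q ≤ demand X q
      crossings-merged≤demand tight = ℤP.≤-trans
        (+-≤-cancelˡ {a = crossings full H (merge X q)} {c = demand full (merge X q)} (tight-merge-split tight) (H-PC _ (merge X q)))
        (demand-merged≤demand X q)

    module _ {k} (Y : VPred n) (q : Fin n → Fin k) (Y-PC : PC Y R) (tight : Tight q) where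

      private
        U = merged Y q

      merge-tight : Tight (merge Y q)
      merge-tight = +-≤-cancelʳ {b = crossings U H q} {d = demand U q} (tight-merge-split Y q tight) (begin
        demand U q          ≤⟨ demand-merged≤demand Y q ⟩
        demand Y q          ≤⟨ Y-PC _ q ⟩
        crossings Y R q     ≤⟨ crossings-mono q (⊆merged Y q) R⊆H ⟩
        crossings U H q     ∎)
        where open ℤP.≤-Reasoning

      -- An M-edge inside U that crosses q is invisible to Y in R, so U would cross more often than its demand.
      merge-keeps-crossing : ∀ {e} → M e ≡ true → crosses full H q e ≡ true → crosses full H (merge Y q) e ≡ true
      merge-keeps-crossing {e} Me crosses-q with crosses full H (merge Y q) e in crosses-merge
      ... | true  = refl
      ... | false = ⊥-elim (ℤP.<⇒≱ more (ℤP.≤-trans (crossings-merged≤demand Y q tight) (Y-PC _ q)))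
        where
        more : crossings Y R q < crossings U H q
        more = sumFin-< (λ x → ι-mono (crosses-mono q (⊆merged Y q) R⊆H x)) e
          (subst₂ (λ b c → ι b < ι c)
            (sym (cong (_∧ _) (trans (cong (λ b → H e ∧ not b) Me) (BP.∧-zeroʳ (H e)))))
            (sym (crosses-merge-split Y q H e crosses-q crosses-merge))
            ι-false<true)

    module _ {k} (p : Fin n → Fin (suc k)) (a : Fin (suc k)) (tight-p : Tight p) where

      private
        A = class p a

      refine-tight : ∀ {j} (q : Fin n → Fin j) → Tight q → Tight (refine p a q)
      refine-tight q tight-q = subst₂ _≤_ (sym (crossings-refine p a q H)) (sym (demand-refine p a q))
        (ℤP.+-mono-≤ tight-p (ℤP.≤-trans (crossings-mono {F = H} {F′ = H} q (⊆merged A q) (λ _ h → h)) (crossings-merged≤demand A q tight-q)))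

      class-PC : (∀ e → M e ≡ true → A (src e) ≡ true → A (tgt e) ≡ true → Empty) → PC A R
      class-PC no-M-inside j q = ℤP.≤-trans
        (+-≤-cancelˡ {a = demand full p} {c = crossings full H p}
          (subst₂ _≤_ (demand-refine p a q) (crossings-refine p a q H) (H-PC _ (refine p a q))) tight-p)
        (sumFin-mono λ e → ι-mono (inside-avoids-M e))
        where
        inside-avoids-M : ∀ e → crosses A H q e ≡ true → crosses A R q e ≡ true
        inside-avoids-M e c with H e | M e in Me | A (src e) in As | A (tgt e) in At
        ... | false | _     | _     | _     = c
        ... | true  | false | _     | _     = c
        ... | true  | true  | true  | true  = ⊥-elim (no-M-inside e Me As At)
        ... | true  | true  | false | _     = case c of λ ()
        ... | true  | true  | true  | false = case c of λ ()

    Swap : Fin m → Fin m → EPred m → Set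
    Swap e e′ H′ = e ≢ e′ × H′ e ≡ false × H′ e′ ≡ true × ∀ x → x ≢ e → x ≢ e′ → H′ x ≡ H x

    module _ {H′ : EPred m} {e e′ : Fin m} (He′ : H e′ ≡ false) (swap : Swap e e′ H′) where

      violation : ∀ {k} (q : Fin n → Fin k) → ¬ (demand full q ≤ crossings full H′ q) →
                  Tight q × crosses full H q e ≡ true × q (src e′) ≐ q (tgt e′) ≡ true
      violation q ¬PC = tight , proj₂ flags , not-crossing
        where
        C  = crossings full H q
        C′ = crossings full H′ q
        c  = crosses full H q e
        c′ = crosses full H′ q e′
        below : C′ < demand full q
        below = ℤP.≰⇒> ¬PC
        e≢e′ = proj₁ swap
        H′e  = proj₁ (proj₂ swap)
        H′e′ = proj₁ (proj₂ (proj₂ swap))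
        H′≗H = proj₂ (proj₂ (proj₂ swap))
        swapped : C′ + ι c ≡ C + ι c′
        swapped = crossings-swap full H H′ q e≢e′ H′e He′ H′≗H
        flags : c′ ≡ false × c ≡ true
        flags = ι-< (+-≡-<-cancel swapped (ℤP.<-≤-trans below (H-PC _ q)))
        tight : Tight q
        tight = begin
          C                ≡⟨ ℤP.+-identityʳ C ⟨
          C + ι false      ≡⟨ cong (λ b → C + ι b) (proj₁ flags) ⟨
          C + ι c′         ≡⟨ swapped ⟨
          C′ + ι c         ≡⟨ cong (λ b → C′ + ι b) (proj₂ flags) ⟩
          C′ + 1ℤ          ≡⟨ ℤP.+-comm C′ 1ℤ ⟩
          1ℤ + C′          ≤⟨ ℤP.i<j⇒suc[i]≤j below ⟩
          demand full q    ∎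
          where open ℤP.≤-Reasoning
        not-crossing : q (src e′) ≐ q (tgt e′) ≡ true
        not-crossing = trans (sym (BP.not-involutive _))
          (cong not (trans (sym (cong (_∧ not (q (src e′) ≐ q (tgt e′))) H′e′)) (proj₁ flags)))

    module _ (H′ : Fin m → EPred m) {e′ : Fin m} (He′ : H e′ ≡ false)
             (swaps : ∀ e → M e ≡ true → Swap e e′ (H′ e))
             {Y₁ Y₂ : VPred n} (Y₁-PC : PC Y₁ R) (Y₂-PC : PC Y₂ R)
             (src∈Y₁ : Y₁ (src e′) ≡ true) (tgt∈Y₂ : Y₂ (tgt e′) ≡ true)
             (separated : ∀ A → PC A R → Y₁ ⊆ᵖ A → Y₂ ⊆ᵖ A → Empty) where

      record Candidate : Set where
        field
          {k}   : ℕ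
          p     : Fin n → Fin (suc k)
          a     : Fin (suc k)
          tight : Tight p
          Y₁⊆A  : Y₁ ⊆ᵖ class p a
          Y₂⊆A  : Y₂ ⊆ᵖ class p a

      open Candidate

      weight : Candidate → ℤ
      weight c = crossings full H (p c)

      trivial : Candidate
      trivial = record
        { k = 0 ; p = λ _ → F.zero ; a = F.zero
        ; tight = subst₂ _≤_ (sym (crossings-constant H (F.zero {0}))) (sym demand-one-part) ℤP.≤-refl
        ; Y₁⊆A = λ _ _ → refl ; Y₂⊆A = λ _ _ → refl }

      merge-ends : ∀ {j} (q : Fin n → Fin j) → Tight q → ∀ {e} → M e ≡ true → crosses full H q e ≡ true →
                   q (src e′) ≐ q (tgt e′) ≡ true →
                   Σ (Fin n → Fin (suc (suc j))) λ q₂ →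
                     Tight q₂ × crosses full H q₂ e ≡ true × Y₁ ⊆ᵖ class q₂ F.zero × Y₂ ⊆ᵖ class q₂ F.zero
      merge-ends q tight {e} Me crosses-q e′-inside =
        q₂ , merge-tight Y₂ q₁ Y₂-PC tight₁ ,
        merge-keeps-crossing Y₂ q₁ Y₂-PC tight₁ Me (merge-keeps-crossing Y₁ q Y₁-PC tight Me crosses-q) ,
        (λ v Y₁v → ≡⇒≐ (Y₁-in-zero v Y₁v)) , (λ v Y₂v → ≡⇒≐ (merge-merged Y₂ q₁ (⊆merged Y₂ q₁ v Y₂v)))
        where
        q₁ = merge Y₁ q
        q₂ = merge Y₂ q₁
        tight₁ = merge-tight Y₁ q Y₁-PC tight
        tgt-in-zero : q₁ (tgt e′) ≡ F.zero
        tgt-in-zero = merge-merged Y₁ q (trans (merged-resp Y₁ q (sym (≐⇒≡ e′-inside))) (⊆merged Y₁ q _ src∈Y₁))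
        Y₁-in-zero : ∀ v → Y₁ v ≡ true → q₂ v ≡ F.zero
        Y₁-in-zero v Y₁v = merge-merged Y₂ q₁
          (trans (merged-resp Y₂ q₁ (trans (merge-merged Y₁ q (⊆merged Y₁ q v Y₁v)) (sym tgt-in-zero)))
                 (⊆merged Y₂ q₁ _ tgt∈Y₂))

      improve : ∀ (c : Candidate) {e} → M e ≡ true → class (p c) (a c) (src e) ≡ true → class (p c) (a c) (tgt e) ≡ true →
                ∀ {j} (q : Fin n → Fin j) → ¬ (demand full q ≤ crossings full (H′ e) q) →
                Σ Candidate λ c′ → weight c < weight c′
      improve c {e} Me As At q ¬PC = c′ , crossings-refine-< (p c) (a c) q₂ H crosses-q₂ As At
        where
        violated = violation He′ (swaps e Me) q ¬PC
        merged-q = merge-ends q (proj₁ violated) Me (proj₁ (proj₂ violated)) (proj₂ (proj₂ violated))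
        q₂ = proj₁ merged-q
        tight₂ = proj₁ (proj₂ merged-q)
        crosses-q₂ = proj₁ (proj₂ (proj₂ merged-q))
        Y₁⊆Q₀ = proj₁ (proj₂ (proj₂ (proj₂ merged-q)))
        Y₂⊆Q₀ = proj₂ (proj₂ (proj₂ (proj₂ merged-q)))
        into-new-class : ∀ {Y} → Y ⊆ᵖ class (p c) (a c) → Y ⊆ᵖ class q₂ F.zero →
                         Y ⊆ᵖ class (refine (p c) (a c) q₂) (suc (k c) ↑ʳ F.zero)
        into-new-class Y⊆A Y⊆Q₀ v Yv = trans (class-refine-↑ʳ (p c) (a c) q₂ F.zero v) (cong₂ _∧_ (Y⊆A v Yv) (Y⊆Q₀ v Yv))
        c′ : Candidate
        c′ = record
          { p = refine (p c) (a c) q₂ ; a = suc (k c) ↑ʳ F.zero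
          ; tight = refine-tight (p c) (a c) (tight c) q₂ tight₂
          ; Y₁⊆A = into-new-class (Y₁⊆A c) Y₁⊆Q₀
          ; Y₂⊆A = into-new-class (Y₂⊆A c) Y₂⊆Q₀ }

      exchange-edge : ∃ λ e → M e ≡ true × PC full (H′ e)
      exchange-edge = search (suc m) trivial
        (subst (λ w → + m < w + + suc m) (sym (crossings-constant H (F.zero {0}))) (ℤ.+<+ (NP.n<1+n m)))
        where
        step : ∀ {w w′} fuel → + m < w + + suc fuel → w < w′ → + m < w′ + + fuel
        step {w} {w′} fuel bound w<w′ =
          ℤP.<-≤-trans (subst (+ m <_) regroup bound) (ℤP.+-monoˡ-≤ (+ fuel) (ℤP.i<j⇒suc[i]≤j w<w′))
          where
          regroup : w + + suc fuel ≡ (1ℤ + w) + + fuel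
          regroup = trans (x∙yz≈y∙xz w 1ℤ (+ fuel)) (sym (ℤP.+-assoc 1ℤ w (+ fuel)))
        search : ∀ fuel (c : Candidate) → + m < weight c + + fuel → ∃ λ e → M e ≡ true × PC full (H′ e)
        search zero c bound =
          ⊥-elim (ℤP.<⇒≱ (subst (+ m <_) (ℤP.+-identityʳ (weight c)) bound) (crossings≤m full H (p c)))
        search (suc fuel) c bound with FP.any? (λ e → (M e BP.≟ true) ×-dec (A (src e) BP.≟ true) ×-dec (A (tgt e) BP.≟ true))
          where
          A = class (p c) (a c)
        ... | no none = ⊥-elim (separated (class (p c) (a c))
                          (class-PC (p c) (a c) (tight c) λ e Me As At → none (e , Me , As , At)) (Y₁⊆A c) (Y₂⊆A c))
        ... | yes (e , Me , As , At) with PC-or-violation (H′ e)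
        ...   | inj₁ pc = e , Me , pc
        ...   | inj₂ (j , q , ¬PC) with improve c Me As At q ¬PC
        ...     | c′ , more = search fuel c′ (step fuel bound more)

mainTheorem17 : ∀ {n m : ℕ} (G : Graph n m) (l : SetFn n) →
    l ⊥ ≡ 0ℤ →
    IntersectingSupermodular l →
    (H : Subset m) → PartitionConnected G l ⊤ H →
    (M : Subset m) → M ⊆ H → Nonempty M →
    (e′ : Fin m) → e′ ∉ H →
    (∃ λ Y₁ → ∃ λ Y₂ →
    IsPCComponent G l (H ─ M) Y₁ × IsPCComponent G l (H ─ M) Y₂ ×
    proj₁ (ends G e′) ∈ Y₁ × proj₂ (ends G e′) ∈ Y₂ × Y₁ ≢ Y₂) →
    ∃ λ e → e ∈ M × PartitionConnected G l ⊤ ((H - e) [ e′ ]≔ inside)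
mainTheorem17 G l l⊥ sup H H-PC M M⊆H _ e′ e′∉H (Y₁ , Y₂ , C₁ , C₂ , src∈Y₁ , tgt∈Y₂ , Y₁≢Y₂) =
  let e , Me , H′-PC = exchange-edge (λ e → lookup ((H - e) [ e′ ]≔ inside)) He′ swaps
                         (component-PC C₁) (component-PC C₂) (VP.[]=⇒lookup src∈Y₁) (VP.[]=⇒lookup tgt∈Y₂)
                         (components-separated C₁ C₂ Y₁≢Y₂)
  in e , VP.lookup⇒[]= e M Me , frozen-of-PC-full H′-PC
  where
  open PartitionConnectivity G l l⊥ sup
  open Exchange (lookup H) (lookup M) (PC-full-of-frozen H-PC)
  He′ : lookup H e′ ≡ false
  He′ = BP.¬-not (e′∉H ∘ VP.lookup⇒[]= e′ H)
  swaps : ∀ e → lookup M e ≡ true → Swap e e′ (lookup ((H - e) [ e′ ]≔ inside))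
  swaps e Me = e≢e′ , lookup-swap-old H e≢e′ , lookup-swap-new H , λ x → lookup-swap-other H
    where
    e≢e′ : e ≢ e′
    e≢e′ refl = e′∉H (M⊆H (VP.lookup⇒[]= e M Me))
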